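{- Let ${\cal F}=(V,E)$ be a hypergraph with $V=[n]$ and all hyperedges of size at most $d$. Then there exists a three-stage group testing algorithm that finds the defective hyperedge in $E$ and uses $O\left(d^{1/3}\log|E|+d\right)$ tests.
   Context: Group testing on a hypergraph: $E$ is a family of subsets (hyperedges) of $[n]=\{1,\ldots,n\}$. An unknown hyperedge $e^*\in E$, the defective hyperedge, is the set of all defective elements. A test is a subset $T\subseteq[n]$ whose response is "yes" if $T\cap e^*\neq\emptyset$ and "no" otherwise. A three-stage algorithm performs its tests in three successive stages; all tests of a stage are decided at the beginning of the stage (they may depend on responses of earlier stages only). The algorithm finds the defective hyperedge if, for every possible $e^*\in E$, it outputs $e^*$. The number of tests is the total over all stages in the worst case; the $O(\cdot)$ hides an absolute constant. Logarithms are base 2. -}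

module Defs where

open import Data.Nat using (ℕ; _+_)
open import Data.Bool using (Bool; true; false; _∧_; _∨_)
open import Data.Vec using (Vec; []; _∷_)
open import Data.List using (List; map; length)
open import Data.Fin.Subset using (Subset)
open import Data.List.Membership.Propositional using (_∈_)
open import Relation.Binary.PropositionalEquality using (_≡_)

meets : ∀ {n} → Subset n → Subset n → Bool
meets []      []      = false
meets (a ∷ T) (b ∷ e) = (a ∧ b) ∨ meets T e

answers : ∀ {n} → Subset n → List (Subset n) → List Bool
answers e Ts = map (λ T → meets T e) Ts

record ThreeStage (n : ℕ) : Set where
  field
    stage1 : List (Subset n)
    stage2 : List Bool → List (Subset n)
    stage3 : List Bool → List Bool → List (Subset n)
    output : List Bool → List Bool → List Bool → Subset n

module _ {n : ℕ} (A : ThreeStage n) (e : Subset n) where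
  open ThreeStage A

  resp1 : List Bool
  resp1 = answers e stage1

  resp2 : List Bool
  resp2 = answers e (stage2 resp1)

  resp3 : List Bool
  resp3 = answers e (stage3 resp1 resp2)

  result : Subset n
  result = output resp1 resp2 resp3

  cost : ℕ
  cost = length stage1 + length (stage2 resp1) + length (stage3 resp1 resp2)

Finds : ∀ {n} → ThreeStage n → List (Subset n) → Set
Finds A E = ∀ e → e ∈ E → result A e ≡ e

{-# OPTIONS --safe #-}
module Submission where

-- Each stage starts from a hyperedge B ∈ E that is consistent with the earlier responses and
-- satisfies ∣e* ─ B∣ ≤ M.  Testing the points of B one at a time reveals e* ∩ B, and hashing
-- [n] into 2M buckets and testing every bucket minus B reveals the image of e* ─ B.  For a
-- hyperedge f with ∣f ─ e*∣ ≥ k, each hash sends all of f ─ e* into that image with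
-- probability at most 2^-k.  So once ∣E∣² < 2^(kt), a union bound over the pairs of
-- hyperedges gives t hashes after which every consistent f has ∣f ─ e*∣ < k.  Such a stage
-- costs ∣B∣ + 2Mt tests.  With r ≈ d^(1/3), the three stages take (M, k) through (d, r²),
-- (r², r) and (r, 1).  Each costs O(d + r log ∣E∣), and after the last one only e* remains
-- consistent.

open import Data.Bool using (Bool; true; false; _∧_; _∨_)
open import Data.Bool.ListAction using (all)
open import Data.Bool.Properties using (∧-identityʳ; ∧-zeroʳ; T-≡)
import Data.Bool.Properties as Bool
open import Data.Fin using (Fin; zero; suc)
open import Data.Fin.Properties using (_≟_)
open import Data.Fin.Subset using (Subset; ∣_∣; _─_; ⊥; inside; outside)
open import Data.Fin.Subset.Properties using (p─⊥≡p; ∣⊥∣≡0)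
open import Data.List using (List; []; _∷_; [_]; _++_; map; length; allFin; tabulate; filter; cartesianProduct; cartesianProductWith)
open import Data.List.Membership.Propositional using (_∈_; find; lose)
import Data.List.Membership.DecPropositional as DecMembership
open import Data.List.Membership.Propositional.Properties
  using (∈-map⁺; ∈-++⁺ˡ; ∈-++⁺ʳ; ∈-allFin; ∈-filter⁺; ∈-filter⁻; ∈-cartesianProduct⁺; ∈-cartesianProductWith⁺)
open import Data.List.Properties using (≡-dec; ∷-injective; length-++; length-map; length-tabulate; length-filter; map-tabulate)
open import Data.List.Relation.Binary.Permutation.Propositional.Properties using (∈-resp-↭; shift)
open import Data.List.Relation.Unary.All using (All)
import Data.List.Relation.Unary.All as All
open import Data.List.Relation.Unary.All.Properties using (all⁻)
open import Data.List.Relation.Unary.Any using (here; there; any?)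
open import Data.List.Relation.Unary.Unique.Propositional using (Unique)
open import Data.Nat using (ℕ; zero; suc; _+_; _*_; _^_; _/_; _%_; _≤_; _<_; z≤n; s≤s; NonZero; >-nonZero; ⌊_/2⌋; ⌈_/2⌉)
open import Data.Nat.DivMod using (m≡m%n+[m/n]*n; m%n<n; m/n*n≤m)
open import Data.Nat.Induction using (<-wellFounded)
open import Data.Nat.Logarithm using (⌈log₂_⌉)
open import Data.Nat.Logarithm.Core using (⌈log2⌉)
open import Data.Nat.Properties hiding (_≟_)
open import Algebra.Properties.CommutativeSemigroup +-commutativeSemigroup
  using () renaming (interchange to +-interchange)
open import Data.Nat.Tactic.RingSolver using (solve-∀)
open import Data.Product using (Σ; ∃; _×_; _,_; proj₁; proj₂)
open import Data.Vec using (Vec; []; _∷_; toList)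
import Data.Vec as Vec
open import Data.Vec.Properties using (length-toList)
open import Function using (_∘_; id)
open import Function.Bundles using (Equivalence)
open import Induction.WellFounded using (Acc; acc)
open import Relation.Binary.PropositionalEquality
  using (_≡_; refl; sym; trans; cong; cong₂; subst; subst₂; module ≡-Reasoning)
open import Relation.Nullary using (Dec; does; yes; no; ¬_; contradiction)
open import Relation.Nullary.Decidable using (_×-dec_; dec-true)
open import Relation.Unary using (Decidable)
open import Relation.Unary.Properties using (_∩?_)

open import Defs

private variable
  A B C : Set
  n : ℕ

-- Finite sums and counting

∑ : List A → (A → ℕ) → ℕ
∑ []       f = 0
∑ (x ∷ xs) f = f x + ∑ xs f

syntax ∑ xs (λ x → e) = ∑[ x ∈ xs ] e

⟦_⟧ : Bool → ℕ
⟦ true  ⟧ = 1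
⟦ false ⟧ = 0

count : (A → Bool) → List A → ℕ
count p xs = ∑[ x ∈ xs ] ⟦ p x ⟧

∑-cong : (xs : List A) {f g : A → ℕ} → (∀ x → f x ≡ g x) → ∑ xs f ≡ ∑ xs g
∑-cong []       f≗g = refl
∑-cong (x ∷ xs) f≗g = cong₂ _+_ (f≗g x) (∑-cong xs f≗g)

∑-mono-≤ : (xs : List A) {f g : A → ℕ} → (∀ x → f x ≤ g x) → ∑ xs f ≤ ∑ xs g
∑-mono-≤ []       f≤g = z≤n
∑-mono-≤ (x ∷ xs) f≤g = +-mono-≤ (f≤g x) (∑-mono-≤ xs f≤g)

∑-++ : (xs ys : List A) (f : A → ℕ) → ∑ (xs ++ ys) f ≡ ∑ xs f + ∑ ys f
∑-++ []       ys f = refl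
∑-++ (x ∷ xs) ys f = trans (cong (f x +_) (∑-++ xs ys f)) (sym (+-assoc (f x) _ _))

∑-map : (g : B → A) (xs : List B) (f : A → ℕ) → ∑ (map g xs) f ≡ ∑ xs (f ∘ g)
∑-map g []       f = refl
∑-map g (x ∷ xs) f = cong (f (g x) +_) (∑-map g xs f)

∑-const : (xs : List A) (c : ℕ) → ∑ xs (λ _ → c) ≡ length xs * c
∑-const []       c = refl
∑-const (x ∷ xs) c = cong (c +_) (∑-const xs c)

length≡∑1 : (xs : List A) → length xs ≡ ∑[ x ∈ xs ] 1
length≡∑1 xs = sym (trans (∑-const xs 1) (*-identityʳ (length xs)))

∑-+ : (xs : List A) (f g : A → ℕ) → ∑[ x ∈ xs ] (f x + g x) ≡ ∑ xs f + ∑ xs g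
∑-+ []       f g = refl
∑-+ (x ∷ xs) f g = trans (cong (f x + g x +_) (∑-+ xs f g)) (+-interchange (f x) (g x) _ _)

∑-*ʳ : (xs : List A) (f : A → ℕ) (c : ℕ) → ∑[ x ∈ xs ] (f x * c) ≡ ∑ xs f * c
∑-*ʳ []       f c = refl
∑-*ʳ (x ∷ xs) f c = trans (cong (f x * c +_) (∑-*ʳ xs f c)) (sym (*-distribʳ-+ c (f x) _))

∑-*ˡ : (xs : List A) (f : A → ℕ) (c : ℕ) → ∑[ x ∈ xs ] (c * f x) ≡ c * ∑ xs f
∑-*ˡ xs f c = begin
  ∑[ x ∈ xs ] (c * f x) ≡⟨ ∑-cong xs (λ x → *-comm c (f x)) ⟩
  ∑[ x ∈ xs ] (f x * c) ≡⟨ ∑-*ʳ xs f c ⟩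
  ∑ xs f * c            ≡⟨ *-comm (∑ xs f) c ⟩
  c * ∑ xs f            ∎
  where open ≡-Reasoning

∑-≤-length* : (xs : List A) {f : A → ℕ} {c : ℕ} → (∀ {x} → x ∈ xs → f x ≤ c) → ∑ xs f ≤ length xs * c
∑-≤-length* []       f≤c = z≤n
∑-≤-length* (x ∷ xs) f≤c = +-mono-≤ (f≤c (here refl)) (∑-≤-length* xs (f≤c ∘ there))

∈⇒≤∑ : {xs : List A} (f : A → ℕ) {x : A} → x ∈ xs → f x ≤ ∑ xs f
∈⇒≤∑ f (here refl)  = m≤m+n _ _
∈⇒≤∑ f (there x∈xs) = ≤-trans (∈⇒≤∑ f x∈xs) (m≤n+m _ _)

∑-<⇒∃-< : (xs : List A) {f g : A → ℕ} → ∑ xs f < ∑ xs g → ∃ λ x → f x < g x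
∑-<⇒∃-< (x ∷ xs) {f} {g} ∑f<∑g with f x <? g x
... | yes fx<gx = x , fx<gx
... | no  fx≮gx = ∑-<⇒∃-< xs (+-cancelˡ-< (f x) _ _ (<-≤-trans ∑f<∑g (+-monoˡ-≤ (∑ xs g) (≮⇒≥ fx≮gx))))

∑-comm : (xs : List A) (ys : List B) (f : A → B → ℕ) →
         ∑[ x ∈ xs ] ∑[ y ∈ ys ] f x y ≡ ∑[ y ∈ ys ] ∑[ x ∈ xs ] f x y
∑-comm []       ys f = trans (sym (*-zeroʳ (length ys))) (sym (∑-const ys 0))
∑-comm (x ∷ xs) ys f = begin
  ∑ ys (f x) + ∑[ x ∈ xs ] ∑[ y ∈ ys ] f x y ≡⟨ cong (∑ ys (f x) +_) (∑-comm xs ys f) ⟩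
  ∑ ys (f x) + ∑[ y ∈ ys ] ∑[ x ∈ xs ] f x y ≡⟨ ∑-+ ys (f x) _ ⟨
  ∑[ y ∈ ys ] (f x y + ∑[ x ∈ xs ] f x y)    ∎
  where open ≡-Reasoning

∑-cartesianProductWith : (_⊕_ : A → B → C) (xs : List A) (ys : List B) (f : C → ℕ) →
  ∑ (cartesianProductWith _⊕_ xs ys) f ≡ ∑[ x ∈ xs ] ∑[ y ∈ ys ] f (x ⊕ y)
∑-cartesianProductWith _⊕_ []       ys f = refl
∑-cartesianProductWith _⊕_ (x ∷ xs) ys f = begin
  ∑ (map (x ⊕_) ys ++ cartesianProductWith _⊕_ xs ys) f
    ≡⟨ ∑-++ (map (x ⊕_) ys) _ f ⟩
  ∑ (map (x ⊕_) ys) f + ∑ (cartesianProductWith _⊕_ xs ys) f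
    ≡⟨ cong₂ _+_ (∑-map (x ⊕_) ys f) (∑-cartesianProductWith _⊕_ xs ys f) ⟩
  ∑[ y ∈ ys ] f (x ⊕ y) + ∑[ x ∈ xs ] ∑[ y ∈ ys ] f (x ⊕ y)
    ∎
  where open ≡-Reasoning

length-cartesianProductWith : (_⊕_ : A → B → C) (xs : List A) (ys : List B) →
  length (cartesianProductWith _⊕_ xs ys) ≡ length xs * length ys
length-cartesianProductWith _⊕_ []       ys = refl
length-cartesianProductWith _⊕_ (x ∷ xs) ys = begin
  length (map (x ⊕_) ys ++ cartesianProductWith _⊕_ xs ys)
    ≡⟨ length-++ (map (x ⊕_) ys) ⟩
  length (map (x ⊕_) ys) + length (cartesianProductWith _⊕_ xs ys)
    ≡⟨ cong₂ _+_ (length-map (x ⊕_) ys) (length-cartesianProductWith _⊕_ xs ys) ⟩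
  length ys + length xs * length ys
    ∎
  where open ≡-Reasoning

⟦∧⟧ : ∀ x y → ⟦ x ∧ y ⟧ ≡ ⟦ x ⟧ * ⟦ y ⟧
⟦∧⟧ true  y = sym (+-identityʳ ⟦ y ⟧)
⟦∧⟧ false y = refl

⟦∨⟧≤ : ∀ x y → ⟦ x ∨ y ⟧ ≤ ⟦ x ⟧ + ⟦ y ⟧
⟦∨⟧≤ true  y = s≤s z≤n
⟦∨⟧≤ false y = ≤-refl

⟦⟧<1⇒false : ∀ {x} → ⟦ x ⟧ < 1 → x ≡ false
⟦⟧<1⇒false {false} _        = refl
⟦⟧<1⇒false {true}  (s≤s ())

∃-avoiding-all : (xs : List A) (is : List B) (bad : B → A → Bool) →
  ∑[ i ∈ is ] count (bad i) xs < length xs → ∃ λ x → ∀ {i} → i ∈ is → bad i x ≡ false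
∃-avoiding-all {A = A} xs is bad total<length = x , λ i∈is → ⟦⟧<1⇒false (≤-<-trans (∈⇒≤∑ _ i∈is) few-at-x)
  where
  per-sample : ∑[ x ∈ xs ] ∑[ i ∈ is ] ⟦ bad i x ⟧ < ∑[ x ∈ xs ] 1
  per-sample = subst₂ _<_ (∑-comm is xs _) (length≡∑1 xs) total<length
  x : A
  x = proj₁ (∑-<⇒∃-< xs per-sample)
  few-at-x : ∑[ i ∈ is ] ⟦ bad i x ⟧ < 1
  few-at-x = proj₂ (∑-<⇒∃-< xs per-sample)

union-bound : (xs : List A) (is : List B) (bad : B → A → Bool) {P : ℕ} →
  0 < length xs → length is < P → (∀ {i} → i ∈ is → count (bad i) xs * P ≤ length xs) →
  ∃ λ x → ∀ {i} → i ∈ is → bad i x ≡ false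
union-bound xs is bad {P} 0<∣xs∣ ∣is∣<P rare = ∃-avoiding-all xs is bad (*-cancelʳ-< P _ _ (begin-strict
  ∑[ i ∈ is ] count (bad i) xs * P   ≡⟨ ∑-*ʳ is (λ i → count (bad i) xs) P ⟨
  ∑[ i ∈ is ] (count (bad i) xs * P) ≤⟨ ∑-≤-length* is rare ⟩
  length is * length xs              <⟨ *-monoˡ-< (length xs) {{>-nonZero 0<∣xs∣}} ∣is∣<P ⟩
  P * length xs                      ≡⟨ *-comm P (length xs) ⟩
  length xs * P                      ∎))
  where open ≤-Reasoning

vectors : List A → (n : ℕ) → List (Vec A n)
vectors xs zero    = [ [] ]
vectors xs (suc n) = cartesianProductWith _∷_ xs (vectors xs n)

length-vectors : (xs : List A) (n : ℕ) → length (vectors xs n) ≡ length xs ^ n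
length-vectors xs zero    = refl
length-vectors xs (suc n) =
  trans (length-cartesianProductWith _∷_ xs (vectors xs n)) (cong (length xs *_) (length-vectors xs n))

count-all-vectors : (p : A → Bool) (xs : List A) {P N : ℕ} → count p xs * P ≤ N →
  ∀ t → count (all p ∘ toList) (vectors xs t) * P ^ t ≤ N ^ t
count-all-vectors p xs         rare zero    = ≤-refl
count-all-vectors p xs {P} {N} rare (suc t) = begin
  count (all p ∘ toList) (vectors xs (suc t)) * (P * P ^ t) ≡⟨ cong (_* (P * P ^ t)) count-suc ⟩
  count p xs * Cₜ * (P * P ^ t)                             ≡⟨ [m*n]*[o*p]≡[m*o]*[n*p] (count p xs) Cₜ P (P ^ t) ⟩
  count p xs * P * (Cₜ * P ^ t)                             ≤⟨ *-mono-≤ rare (count-all-vectors p xs rare t) ⟩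
  N * N ^ t                                                 ∎
  where
  open ≤-Reasoning
  Cₜ : ℕ
  Cₜ = count (all p ∘ toList) (vectors xs t)
  factor : ∀ x → ∑[ v ∈ vectors xs t ] ⟦ p x ∧ all p (toList v) ⟧ ≡ ⟦ p x ⟧ * Cₜ
  factor x = trans (∑-cong (vectors xs t) (λ v → ⟦∧⟧ (p x) _)) (∑-*ˡ (vectors xs t) _ ⟦ p x ⟧)
  count-suc : count (all p ∘ toList) (vectors xs (suc t)) ≡ count p xs * Cₜ
  count-suc = begin-equality
    count (all p ∘ toList) (vectors xs (suc t))                  ≡⟨ ∑-cartesianProductWith _∷_ xs (vectors xs t) _ ⟩
    ∑[ x ∈ xs ] ∑[ v ∈ vectors xs t ] ⟦ p x ∧ all p (toList v) ⟧ ≡⟨ ∑-cong xs factor ⟩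
    ∑[ x ∈ xs ] (⟦ p x ⟧ * Cₜ)                                    ≡⟨ ∑-*ʳ xs _ Cₜ ⟩
    count p xs * Cₜ                                               ∎

∑-allFin-suc : ∀ {q} (f : Fin (suc q) → ℕ) → ∑ (allFin (suc q)) f ≡ f zero + ∑ (allFin q) (f ∘ suc)
∑-allFin-suc {q} f = cong (f zero +_) (begin
  ∑ (tabulate suc) f       ≡⟨ cong (λ xs → ∑ xs f) (map-tabulate id suc) ⟨
  ∑ (map suc (allFin q)) f ≡⟨ ∑-map suc (allFin q) f ⟩
  ∑ (allFin q) (f ∘ suc)   ∎)
  where open ≡-Reasoning

count-≟ : ∀ {q} (y : Fin q) → count (λ c → does (c ≟ y)) (allFin q) ≡ 1
count-≟ {suc q} zero    = trans (∑-allFin-suc {q} (λ c → ⟦ does (c ≟ zero) ⟧))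
                                (cong suc (trans (∑-const (allFin q) 0) (*-zeroʳ (length (allFin q)))))
count-≟ {suc q} (suc y) = trans (∑-allFin-suc {q} (λ c → ⟦ does (c ≟ suc y) ⟧)) (count-≟ y)

-- Tests on subsets

from-does-≡ : ∀ {P Q : Set} (p? : Dec P) (q? : Dec Q) → does p? ≡ does q? → Q → P
from-does-≡ (yes p) q? same q = p
from-does-≡ (no ¬p) q? same q with () ← trans same (dec-true q? q)

answers-≡⇒meets-≡ : {e f : Subset n} {Ts : List (Subset n)} → answers e Ts ≡ answers f Ts →
                    ∀ {T} → T ∈ Ts → meets T e ≡ meets T f
answers-≡⇒meets-≡ same (here refl)  = proj₁ (∷-injective same)
answers-≡⇒meets-≡ same (there T∈Ts) = answers-≡⇒meets-≡ (proj₂ (∷-injective same)) T∈Ts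

meets-⊥ : (e : Subset n) → meets ⊥ e ≡ false
meets-⊥ []      = refl
meets-⊥ (x ∷ e) = meets-⊥ e

meets-─ : (T B e : Subset n) → meets (T ─ B) e ≡ meets T (e ─ B)
meets-─ []      []            []      = refl
meets-─ (t ∷ T) (inside  ∷ B) (x ∷ e) = cong₂ _∨_ (sym (∧-zeroʳ t)) (meets-─ T B e)
meets-─ (t ∷ T) (outside ∷ B) (x ∷ e) = cong ((t ∧ x) ∨_) (meets-─ T B e)

∣p∣≤0⇒p≡⊥ : (p : Subset n) → ∣ p ∣ ≤ 0 → p ≡ ⊥
∣p∣≤0⇒p≡⊥ []            _     = refl
∣p∣≤0⇒p≡⊥ (outside ∷ p) ∣p∣≤0 = cong (outside ∷_) (∣p∣≤0⇒p≡⊥ p ∣p∣≤0)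

─-antisym : (p q : Subset n) → ∣ p ─ q ∣ ≤ 0 → ∣ q ─ p ∣ ≤ 0 → p ≡ q
─-antisym []            []            _   _   = refl
─-antisym (inside  ∷ p) (inside  ∷ q) p─q q─p = cong (inside  ∷_) (─-antisym p q p─q q─p)
─-antisym (outside ∷ p) (outside ∷ q) p─q q─p = cong (outside ∷_) (─-antisym p q p─q q─p)

singletons : Subset n → List (Subset n)
singletons []            = []
singletons (inside  ∷ B) = (inside ∷ ⊥) ∷ map (outside ∷_) (singletons B)
singletons (outside ∷ B) = map (outside ∷_) (singletons B)

length-singletons : (B : Subset n) → length (singletons B) ≡ ∣ B ∣
length-singletons []            = refl
length-singletons (inside  ∷ B) = cong suc (trans (length-map (outside ∷_) (singletons B)) (length-singletons B))
length-singletons (outside ∷ B) = trans (length-map (outside ∷_) (singletons B)) (length-singletons B)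

singletons-agree⇒f─e≡[f─B]─[e─B] : (B e f : Subset n) →
  (∀ {T} → T ∈ singletons B → meets T e ≡ meets T f) → f ─ e ≡ (f ─ B) ─ (e ─ B)
singletons-agree⇒f─e≡[f─B]─[e─B] []            []            []            _     = refl
singletons-agree⇒f─e≡[f─B]─[e─B] (inside  ∷ B) (inside  ∷ e) (inside  ∷ f) agree =
  cong (outside ∷_) (singletons-agree⇒f─e≡[f─B]─[e─B] B e f (agree ∘ there ∘ ∈-map⁺ (outside ∷_)))
singletons-agree⇒f─e≡[f─B]─[e─B] (inside  ∷ B) (outside ∷ e) (outside ∷ f) agree =
  cong (outside ∷_) (singletons-agree⇒f─e≡[f─B]─[e─B] B e f (agree ∘ there ∘ ∈-map⁺ (outside ∷_)))
singletons-agree⇒f─e≡[f─B]─[e─B] (inside  ∷ B) (inside  ∷ e) (outside ∷ f) agree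
  with () ← trans (agree (here refl)) (meets-⊥ f)
singletons-agree⇒f─e≡[f─B]─[e─B] (inside  ∷ B) (outside ∷ e) (inside  ∷ f) agree
  with () ← trans (sym (meets-⊥ e)) (agree (here refl))
singletons-agree⇒f─e≡[f─B]─[e─B] (outside ∷ B) (inside  ∷ e) (y       ∷ f) agree =
  cong (outside ∷_) (singletons-agree⇒f─e≡[f─B]─[e─B] B e f (agree ∘ ∈-map⁺ (outside ∷_)))
singletons-agree⇒f─e≡[f─B]─[e─B] (outside ∷ B) (outside ∷ e) (y       ∷ f) agree =
  cong (y ∷_) (singletons-agree⇒f─e≡[f─B]─[e─B] B e f (agree ∘ ∈-map⁺ (outside ∷_)))

Separates : List (Subset n) → Subset n → ℕ → ℕ → List (Subset n) → Set
Separates E B M k Ts =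
  ∀ {e f} → e ∈ E → f ∈ E → answers e Ts ≡ answers f Ts → ∣ e ─ B ∣ ≤ M → ∣ f ─ e ∣ < k

-- Hashing

module Hashing (q : ℕ) where

  open DecMembership (_≟_ {q}) using (_∈?_)

  Hash : ℕ → Set
  Hash n = Vec (Fin q) n

  hashes : ∀ n → List (Hash n)
  hashes = vectors (allFin q)

  length-hashes : ∀ n → length (hashes n) ≡ q ^ n
  length-hashes n = trans (length-vectors (allFin q) n) (cong (_^ n) (length-tabulate {n = q} id))

  count-∈ : (L : List (Fin q)) → count (λ c → does (c ∈? L)) (allFin q) ≤ length L
  count-∈ []      = ≤-reflexive (trans (∑-const (allFin q) 0) (*-zeroʳ (length (allFin q))))
  count-∈ (y ∷ L) = begin
    count (λ c → does (c ≟ y) ∨ does (c ∈? L)) (allFin q)    ≤⟨ ∑-mono-≤ (allFin q) (λ c → ⟦∨⟧≤ (does (c ≟ y)) _) ⟩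
    ∑[ c ∈ allFin q ] (⟦ does (c ≟ y) ⟧ + ⟦ does (c ∈? L) ⟧) ≡⟨ ∑-+ (allFin q) _ _ ⟩
    count (λ c → does (c ≟ y)) (allFin q)
      + count (λ c → does (c ∈? L)) (allFin q)               ≤⟨ +-mono-≤ (≤-reflexive (count-≟ y)) (count-∈ L) ⟩
    1 + length L                                             ∎
    where open ≤-Reasoning

  image : Hash n → Subset n → List (Fin q)
  image []      []            = []
  image (c ∷ h) (inside  ∷ a) = c ∷ image h a
  image (c ∷ h) (outside ∷ a) = image h a

  length-image : (h : Hash n) (a : Subset n) → length (image h a) ≡ ∣ a ∣
  length-image []      []            = refl
  length-image (c ∷ h) (inside  ∷ a) = cong suc (length-image h a)
  length-image (c ∷ h) (outside ∷ a) = length-image h a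

  image-∷⁺ : ∀ {c : Fin q} {h : Hash n} {x b j} → j ∈ image h b → j ∈ image (c ∷ h) (x ∷ b)
  image-∷⁺ {x = inside}  j∈hb = there j∈hb
  image-∷⁺ {x = outside} j∈hb = j∈hb

  preimage : Hash n → Fin q → Subset n
  preimage h j = Vec.map (λ c → does (j ≟ c)) h

  meets-preimage : (h : Hash n) (j : Fin q) (a : Subset n) → meets (preimage h j) a ≡ does (j ∈? image h a)
  meets-preimage []      j []            = refl
  meets-preimage (c ∷ h) j (inside  ∷ a) = cong₂ _∨_ (∧-identityʳ (does (j ≟ c))) (meets-preimage h j a)
  meets-preimage (c ∷ h) j (outside ∷ a) = cong₂ _∨_ (∧-zeroʳ (does (j ≟ c))) (meets-preimage h j a)

  -- covered Y a b h: h sends every point of b ─ a into Y or into the image of a.  Walking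
  -- along the points, Y collects the hash values of the points of a already passed, so each
  -- point of b ─ a is checked only against values chosen independently of its own.
  covered : List (Fin q) → Subset n → Subset n → Hash n → Bool
  covered Y []            []            []      = true
  covered Y (inside  ∷ a) (_       ∷ b) (c ∷ h) = covered (c ∷ Y) a b h
  covered Y (outside ∷ a) (inside  ∷ b) (c ∷ h) = does (c ∈? (Y ++ image h a)) ∧ covered Y a b h
  covered Y (outside ∷ a) (outside ∷ b) (c ∷ h) = covered Y a b h

  covered-intro : (Y : List (Fin q)) (a b : Subset n) (h : Hash n) →
    (∀ {j} → j ∈ image h b → j ∈ Y ++ image h a) → covered Y a b h ≡ true
  covered-intro Y []            []            []      _   = refl
  covered-intro Y (inside  ∷ a) (x       ∷ b) (c ∷ h) hb⊆ =
    covered-intro (c ∷ Y) a b h (∈-resp-↭ (shift c Y (image h a)) ∘ hb⊆ ∘ image-∷⁺ {x = x})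
  covered-intro Y (outside ∷ a) (inside  ∷ b) (c ∷ h) hb⊆ =
    cong₂ _∧_ (dec-true (c ∈? (Y ++ image h a)) (hb⊆ (here refl))) (covered-intro Y a b h (hb⊆ ∘ there))
  covered-intro Y (outside ∷ a) (outside ∷ b) (c ∷ h) hb⊆ = covered-intro Y a b h hb⊆

  count-∷ : (p : Hash (suc n) → Bool) →
            count p (hashes (suc n)) ≡ ∑[ c ∈ allFin q ] count (p ∘ (c ∷_)) (hashes n)
  count-∷ {n} p = ∑-cartesianProductWith _∷_ (allFin q) (hashes n) (⟦_⟧ ∘ p)

  count-∷-≤ : (p : Hash (suc n) → Bool) {S : ℕ} → (∀ c → count (p ∘ (c ∷_)) (hashes n) * S ≤ q ^ n) →
              count p (hashes (suc n)) * S ≤ q ^ suc n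
  count-∷-≤ {n} p {S} bound = begin
    count p (hashes (suc n)) * S                          ≡⟨ cong (_* S) (count-∷ p) ⟩
    (∑[ c ∈ allFin q ] count (p ∘ (c ∷_)) (hashes n)) * S ≡⟨ ∑-*ʳ (allFin q) _ S ⟨
    ∑[ c ∈ allFin q ] (count (p ∘ (c ∷_)) (hashes n) * S) ≤⟨ ∑-≤-length* (allFin q) (λ {c} _ → bound c) ⟩
    length (allFin q) * q ^ n                             ≡⟨ cong (_* q ^ n) (length-tabulate {n = q} id) ⟩
    q * q ^ n                                             ∎
    where open ≤-Reasoning

  count-∈-image : {M : ℕ} (Y : List (Fin q)) (a : Subset n) (R : Hash n → Bool) → length Y + ∣ a ∣ ≤ M →
    ∑[ c ∈ allFin q ] count (λ h → does (c ∈? (Y ++ image h a)) ∧ R h) (hashes n) ≤ M * count R (hashes n)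
  count-∈-image {n} {M} Y a R small = begin
    ∑[ c ∈ allFin q ] ∑[ h ∈ hashes n ] ⟦ hit c h ∧ R h ⟧       ≡⟨ ∑-comm (allFin q) (hashes n) _ ⟩
    ∑[ h ∈ hashes n ] ∑[ c ∈ allFin q ] ⟦ hit c h ∧ R h ⟧       ≡⟨ ∑-cong (hashes n) factor ⟩
    ∑[ h ∈ hashes n ] (count (λ c → hit c h) (allFin q) * ⟦ R h ⟧) ≤⟨ ∑-mono-≤ (hashes n) (λ h → *-monoˡ-≤ ⟦ R h ⟧ (few-hits h)) ⟩
    ∑[ h ∈ hashes n ] (M * ⟦ R h ⟧)                              ≡⟨ ∑-*ˡ (hashes n) (⟦_⟧ ∘ R) M ⟩
    M * count R (hashes n)                                       ∎
    where
    open ≤-Reasoning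
    hit : Fin q → Hash n → Bool
    hit c h = does (c ∈? (Y ++ image h a))
    factor : ∀ h → ∑[ c ∈ allFin q ] ⟦ hit c h ∧ R h ⟧ ≡ count (λ c → hit c h) (allFin q) * ⟦ R h ⟧
    factor h = trans (∑-cong (allFin q) (λ c → ⟦∧⟧ (hit c h) (R h))) (∑-*ʳ (allFin q) _ ⟦ R h ⟧)
    few-hits : ∀ h → count (λ c → hit c h) (allFin q) ≤ M
    few-hits h = begin
      count (λ c → hit c h) (allFin q) ≤⟨ count-∈ (Y ++ image h a) ⟩
      length (Y ++ image h a)          ≡⟨ trans (length-++ Y) (cong (length Y +_) (length-image h a)) ⟩
      length Y + ∣ a ∣                 ≤⟨ small ⟩
      M                                ∎

  -- Each point of b ─ a has at most M admissible values among q ≥ 2M.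
  count-covered : {M : ℕ} → 2 * M ≤ q → (Y : List (Fin q)) (a b : Subset n) → length Y + ∣ a ∣ ≤ M →
                  count (covered Y a b) (hashes n) * 2 ^ ∣ b ─ a ∣ ≤ q ^ n
  count-covered         2M≤q Y []            []            small = ≤-refl
  count-covered {M = M} 2M≤q Y (inside  ∷ a) (x       ∷ b) small =
    count-∷-≤ (covered Y (inside ∷ a) (x ∷ b))
      (λ c → count-covered 2M≤q (c ∷ Y) a b (subst (_≤ M) (+-suc (length Y) ∣ a ∣) small))
  count-covered         2M≤q Y (outside ∷ a) (outside ∷ b) small =
    count-∷-≤ (covered Y (outside ∷ a) (outside ∷ b)) (λ c → count-covered 2M≤q Y a b small)
  count-covered {suc n} {M} 2M≤q Y (outside ∷ a) (inside  ∷ b) small = begin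
    count (covered Y (outside ∷ a) (inside ∷ b)) (hashes (suc n)) * (2 * 2 ^ s)
      ≡⟨ cong (_* (2 * 2 ^ s)) (count-∷ (covered Y (outside ∷ a) (inside ∷ b))) ⟩
    ∑[ c ∈ allFin q ] count (λ h → does (c ∈? (Y ++ image h a)) ∧ R h) (hashes n) * (2 * 2 ^ s)
      ≤⟨ *-monoˡ-≤ (2 * 2 ^ s) (count-∈-image Y a R small) ⟩
    M * count R (hashes n) * (2 * 2 ^ s)
      ≡⟨ [m*n]*[o*p]≡[m*o]*[n*p] M (count R (hashes n)) 2 (2 ^ s) ⟩
    M * 2 * (count R (hashes n) * 2 ^ s)
      ≤⟨ *-mono-≤ (≤-trans (≤-reflexive (*-comm M 2)) 2M≤q) (count-covered 2M≤q Y a b small) ⟩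
    q * q ^ n
      ∎
    where
    open ≤-Reasoning
    s : ℕ
    s = ∣ b ─ a ∣
    R : Hash n → Bool
    R = covered Y a b

  hashTests : Subset n → List (Hash n) → List (Subset n)
  hashTests B hs = cartesianProductWith (λ h j → preimage h j ─ B) hs (allFin q)

  length-hashTests : (B : Subset n) (hs : List (Hash n)) → length (hashTests B hs) ≡ length hs * q
  length-hashTests B hs =
    trans (length-cartesianProductWith _ hs (allFin q)) (cong (length hs *_) (length-tabulate {n = q} id))

  hashTests-agree⇒covered : (B e f : Subset n) (hs : List (Hash n)) →
    (∀ {T} → T ∈ hashTests B hs → meets T e ≡ meets T f) → ∀ {h} → h ∈ hs → covered [] (e ─ B) (f ─ B) h ≡ true
  hashTests-agree⇒covered B e f hs agree {h} h∈hs = covered-intro [] (e ─ B) (f ─ B) h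
    (λ {j} → from-does-≡ (j ∈? image h (e ─ B)) (j ∈? image h (f ─ B)) (same-image j))
    where
    same-image : ∀ j → does (j ∈? image h (e ─ B)) ≡ does (j ∈? image h (f ─ B))
    same-image j = begin
      does (j ∈? image h (e ─ B))  ≡⟨ meets-preimage h j (e ─ B) ⟨
      meets (preimage h j) (e ─ B) ≡⟨ meets-─ (preimage h j) B e ⟨
      meets (preimage h j ─ B) e   ≡⟨ agree (∈-cartesianProductWith⁺ _ h∈hs (∈-allFin j)) ⟩
      meets (preimage h j ─ B) f   ≡⟨ meets-─ (preimage h j) B f ⟩
      meets (preimage h j) (f ─ B) ≡⟨ meets-preimage h j (f ─ B) ⟩
      does (j ∈? image h (f ─ B))  ∎
      where open ≡-Reasoning

-- One stage

module Refinement {n : ℕ} (E : List (Subset n)) (B : Subset n) (M k t : ℕ) .{{_ : NonZero M}} where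

  open Hashing (2 * M)

  tests : Vec (Hash n) t → List (Subset n)
  tests hs = singletons B ++ hashTests B (toList hs)

  length-tests : (hs : Vec (Hash n) t) → length (tests hs) ≡ ∣ B ∣ + t * (2 * M)
  length-tests hs = trans (length-++ (singletons B))
    (cong₂ _+_ (length-singletons B) (trans (length-hashTests B (toList hs)) (cong (_* (2 * M)) (length-toList hs))))

  Far : Subset n × Subset n → Set
  Far (e , f) = ∣ e ─ B ∣ ≤ M × k ≤ ∣ (f ─ B) ─ (e ─ B) ∣

  far? : Decidable Far
  far? (e , f) = ∣ e ─ B ∣ ≤? M ×-dec k ≤? ∣ (f ─ B) ─ (e ─ B) ∣

  farPairs : List (Subset n × Subset n)
  farPairs = filter far? (cartesianProduct E E)

  confused : Subset n × Subset n → Vec (Hash n) t → Bool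
  confused (e , f) hs = all (covered [] (e ─ B) (f ─ B)) (toList hs)

  samples : List (Vec (Hash n) t)
  samples = vectors (hashes n) t

  length-samples : length samples ≡ ((2 * M) ^ n) ^ t
  length-samples = trans (length-vectors (hashes n) t) (cong (_^ t) (length-hashes n))

  rarely-confused : ∀ {i} → i ∈ farPairs → count (confused i) samples * 2 ^ (k * t) ≤ length samples
  rarely-confused {e , f} i∈farPairs = begin
    count (confused (e , f)) samples * 2 ^ (k * t) ≡⟨ cong (count (confused (e , f)) samples *_) (^-*-assoc 2 k t) ⟨
    count (confused (e , f)) samples * (2 ^ k) ^ t ≤⟨ count-all-vectors (covered [] (e ─ B) (f ─ B)) (hashes n) one-hash t ⟩
    ((2 * M) ^ n) ^ t                              ≡⟨ length-samples ⟨
    length samples                                 ∎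
    where
    open ≤-Reasoning
    far : Far (e , f)
    far = proj₂ (∈-filter⁻ far? {xs = cartesianProduct E E} i∈farPairs)
    one-hash : count (covered [] (e ─ B) (f ─ B)) (hashes n) * 2 ^ k ≤ (2 * M) ^ n
    one-hash = ≤-trans (*-monoʳ-≤ (count (covered [] (e ─ B) (f ─ B)) (hashes n)) (^-monoʳ-≤ 2 (proj₂ far)))
                       (count-covered ≤-refl [] (e ─ B) (f ─ B) (proj₁ far))

  good-hashes : length E * length E < 2 ^ (k * t) → ∃ λ hs → ∀ {i} → i ∈ farPairs → confused i hs ≡ false
  good-hashes few-pairs = union-bound samples farPairs confused samples-nonempty
    (≤-<-trans (≤-trans (length-filter far? (cartesianProduct E E)) (≤-reflexive (length-cartesianProductWith _,_ E E)))
               few-pairs)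
    rarely-confused
    where
    samples-nonempty : 0 < length samples
    samples-nonempty = subst (0 <_) (sym length-samples) (m^n>0 ((2 * M) ^ n) {{m^n≢0 (2 * M) n {{m*n≢0 2 M}}}} t)

  separates : (hs : Vec (Hash n) t) → (∀ {i} → i ∈ farPairs → confused i hs ≡ false) → Separates E B M k (tests hs)
  separates hs unconfused {e} {f} e∈E f∈E same e─B≤M = ≰⇒> not-far
    where
    agree : ∀ {T} → T ∈ tests hs → meets T e ≡ meets T f
    agree = answers-≡⇒meets-≡ same
    far-pair : k ≤ ∣ f ─ e ∣ → (e , f) ∈ farPairs
    far-pair k≤∣f─e∣ = ∈-filter⁺ far? (∈-cartesianProduct⁺ e∈E f∈E) (e─B≤M , subst (λ p → k ≤ ∣ p ∣)
      (singletons-agree⇒f─e≡[f─B]─[e─B] B e f (agree ∘ ∈-++⁺ˡ)) k≤∣f─e∣)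
    confused-by-tests : confused (e , f) hs ≡ true
    confused-by-tests = Equivalence.to T-≡ (all⁻ (covered [] (e ─ B) (f ─ B)) (All.tabulate
      (Equivalence.from T-≡ ∘ hashTests-agree⇒covered B e f (toList hs) (agree ∘ ∈-++⁺ʳ (singletons B)))))
    not-far : ¬ k ≤ ∣ f ─ e ∣
    not-far k≤∣f─e∣ with () ← trans (sym confused-by-tests) (unconfused (far-pair k≤∣f─e∣))

refinement : (E : List (Subset n)) (B : Subset n) (M k t : ℕ) .{{_ : NonZero M}} →
  length E * length E < 2 ^ (k * t) →
  Σ (List (Subset n)) λ Ts → length Ts ≡ ∣ B ∣ + t * (2 * M) × Separates E B M k Ts
refinement {n} E B M k t few-pairs = tests hs , length-tests hs , separates hs unconfused
  where
  open Refinement E B M k t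
  hs : Vec (Vec (Fin (2 * M)) n) t
  hs = proj₁ (good-hashes few-pairs)
  unconfused : ∀ {i} → i ∈ farPairs → confused i hs ≡ false
  unconfused = proj₂ (good-hashes few-pairs)

-- Three stages

module Decoding {n : ℕ} (E : List (Subset n)) where

  decode : {P : Subset n → Set} → Decidable P → Subset n
  decode P? with any? P? E
  ... | yes ∃P = proj₁ (find ∃P)
  ... | no  _  = ⊥

  decode-sound : {P : Subset n → Set} (P? : Decidable P) {e : Subset n} → e ∈ E → P e → decode P? ∈ E × P (decode P?)
  decode-sound P? e∈E Pe with any? P? E
  ... | yes ∃P = proj₂ (find ∃P)
  ... | no  ∄P = contradiction (lose e∈E Pe) ∄P

  Agrees : List (Subset n) → List Bool → Subset n → Set
  Agrees Ts ρ f = answers f Ts ≡ ρ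

  agrees? : (Ts : List (Subset n)) (ρ : List Bool) → Decidable (Agrees Ts ρ)
  agrees? Ts ρ f = ≡-dec Bool._≟_ (answers f Ts) ρ

module ThreeStages {n : ℕ} (E : List (Subset n)) (T₁ : List (Subset n)) (T₂ T₃ : Subset n → List (Subset n)) where

  open Decoding E

  candidate₁ : List Bool → Subset n
  candidate₁ ρ₁ = decode (agrees? T₁ ρ₁)

  candidate₂ : List Bool → List Bool → Subset n
  candidate₂ ρ₁ ρ₂ = decode (agrees? T₁ ρ₁ ∩? agrees? (T₂ (candidate₁ ρ₁)) ρ₂)

  candidate₃ : List Bool → List Bool → List Bool → Subset n
  candidate₃ ρ₁ ρ₂ ρ₃ =
    decode ((agrees? T₁ ρ₁ ∩? agrees? (T₂ (candidate₁ ρ₁)) ρ₂) ∩? agrees? (T₃ (candidate₂ ρ₁ ρ₂)) ρ₃)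

  algorithm : ThreeStage n
  algorithm = record
    { stage1 = T₁
    ; stage2 = T₂ ∘ candidate₁
    ; stage3 = λ ρ₁ ρ₂ → T₃ (candidate₂ ρ₁ ρ₂)
    ; output = candidate₃
    }

  module Run {e : Subset n} (e∈E : e ∈ E) where

    ρ₁ ρ₂ ρ₃ : List Bool
    ρ₁ = resp1 algorithm e
    ρ₂ = resp2 algorithm e
    ρ₃ = resp3 algorithm e

    e₀ e₁ o : Subset n
    e₀ = candidate₁ ρ₁
    e₁ = candidate₂ ρ₁ ρ₂
    o  = result algorithm e

    e₀-sound : e₀ ∈ E × Agrees T₁ ρ₁ e₀
    e₀-sound = decode-sound (agrees? T₁ ρ₁) e∈E refl

    e₁-sound : e₁ ∈ E × Agrees T₁ ρ₁ e₁ × Agrees (T₂ e₀) ρ₂ e₁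
    e₁-sound = decode-sound (agrees? T₁ ρ₁ ∩? agrees? (T₂ e₀) ρ₂) e∈E (refl , refl)

    o-sound : o ∈ E × (Agrees T₁ ρ₁ o × Agrees (T₂ e₀) ρ₂ o) × Agrees (T₃ e₁) ρ₃ o
    o-sound = decode-sound ((agrees? T₁ ρ₁ ∩? agrees? (T₂ e₀) ρ₂) ∩? agrees? (T₃ e₁) ρ₃) e∈E ((refl , refl) , refl)

  finds : {d k₁ k₂ : ℕ} → All (λ e → ∣ e ∣ ≤ d) E →
          Separates E ⊥ d k₁ T₁ → (∀ B → Separates E B k₁ k₂ (T₂ B)) → (∀ B → Separates E B k₂ 1 (T₃ B)) →
          Finds algorithm E
  finds {d} {k₁} {k₂} small S₁ S₂ S₃ e e∈E = ─-antisym o e (≤-pred o─e<1) (≤-pred e─o<1)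
    where
    open Run e∈E
    e₁─e₀<k₁ : ∣ e₁ ─ e₀ ∣ < k₁
    e₁─e₀<k₁ = S₁ (proj₁ e₀-sound) (proj₁ e₁-sound) (trans (proj₂ e₀-sound) (sym (proj₁ (proj₂ e₁-sound))))
                  (subst (λ p → ∣ p ∣ ≤ d) (sym (p─⊥≡p e₀)) (All.lookup small (proj₁ e₀-sound)))
    e─e₁<k₂ : ∣ e ─ e₁ ∣ < k₂
    e─e₁<k₂ = S₂ e₀ (proj₁ e₁-sound) e∈E (proj₂ (proj₂ e₁-sound)) (<⇒≤ e₁─e₀<k₁)
    o─e₁<k₂ : ∣ o ─ e₁ ∣ < k₂
    o─e₁<k₂ = S₂ e₀ (proj₁ e₁-sound) (proj₁ o-sound)
                 (trans (proj₂ (proj₂ e₁-sound)) (sym (proj₂ (proj₁ (proj₂ o-sound))))) (<⇒≤ e₁─e₀<k₁)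
    o─e<1 : ∣ o ─ e ∣ < 1
    o─e<1 = S₃ e₁ e∈E (proj₁ o-sound) (sym (proj₂ (proj₂ o-sound))) (<⇒≤ e─e₁<k₂)
    e─o<1 : ∣ e ─ o ∣ < 1
    e─o<1 = S₃ e₁ (proj₁ o-sound) e∈E (proj₂ (proj₂ o-sound)) (<⇒≤ o─e₁<k₂)

  cost-≤ : {c : ℕ} → length T₁ ≤ c →
           (∀ {B} → B ∈ E → length (T₂ B) ≤ c) → (∀ {B} → B ∈ E → length (T₃ B) ≤ c) →
           ∀ {e} → e ∈ E → cost algorithm e ≤ c + c + c
  cost-≤ T₁≤c T₂≤c T₃≤c e∈E = +-mono-≤ (+-mono-≤ T₁≤c (T₂≤c (proj₁ e₀-sound))) (T₃≤c (proj₁ e₁-sound))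
    where open Run e∈E

-- Choice of parameters

n≤2^⌈log2⌉n : ∀ m (acc : Acc _<_ m) → m ≤ 2 ^ ⌈log2⌉ m acc
n≤2^⌈log2⌉n 0             _        = z≤n
n≤2^⌈log2⌉n 1             _        = s≤s z≤n
n≤2^⌈log2⌉n (suc (suc m)) (acc rs) = begin
  2 + m                                         ≡⟨ cong (2 +_) (⌊n/2⌋+⌈n/2⌉≡n m) ⟨
  2 + (⌊ m /2⌋ + ⌈ m /2⌉)                       ≤⟨ +-monoʳ-≤ 2 (+-monoˡ-≤ ⌈ m /2⌉ (⌊n/2⌋≤⌈n/2⌉ m)) ⟩
  2 + (⌈ m /2⌉ + ⌈ m /2⌉)                       ≡⟨ 2+[x+x]≡2*[1+x] ⌈ m /2⌉ ⟩
  2 * suc ⌈ m /2⌉                               ≤⟨ *-monoʳ-≤ 2 (n≤2^⌈log2⌉n (suc ⌈ m /2⌉) (rs (⌈n/2⌉<n m))) ⟩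
  2 * 2 ^ ⌈log2⌉ (suc ⌈ m /2⌉) (rs (⌈n/2⌉<n m)) ∎
  where
  open ≤-Reasoning
  2+[x+x]≡2*[1+x] : ∀ x → 2 + (x + x) ≡ 2 * suc x
  2+[x+x]≡2*[1+x] = solve-∀

n≤2^⌈log₂n⌉ : ∀ m → m ≤ 2 ^ ⌈log₂ m ⌉
n≤2^⌈log₂n⌉ m = n≤2^⌈log2⌉n m (<-wellFounded m)

[2x]^3≡8*x^3 : ∀ x → (2 * x) ^ 3 ≡ 8 * x ^ 3
[2x]^3≡8*x^3 x = unfolded x
  where
  -- the ring solver rejects powers of compound terms, but ^ 3 unfolds definitionally
  unfolded : ∀ x → (2 * x) * ((2 * x) * ((2 * x) * 1)) ≡ 8 * (x * (x * (x * 1)))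
  unfolded = solve-∀

cube-root : ∀ d → ∃ λ r → suc d ≤ suc r ^ 3 × suc r ^ 3 ≤ 8 * suc d
cube-root zero = 0 , ≤-refl , s≤s z≤n
cube-root (suc d) with cube-root d
... | r , lo , hi with suc (suc d) ≤? suc r ^ 3
...   | yes lo′ = r , lo′ , ≤-trans hi (*-monoʳ-≤ 8 (n≤1+n (suc d)))
...   | no  lo̸  = suc r , next-lo , next-hi
  where
  exact : suc r ^ 3 ≡ suc d
  exact = ≤-antisym (≤-pred (≰⇒> lo̸)) lo
  next-lo : suc (suc d) ≤ suc (suc r) ^ 3
  next-lo = subst (λ x → suc x ≤ suc (suc r) ^ 3) exact (^-monoˡ-< 3 (n<1+n (suc r)))
  next-hi : suc (suc r) ^ 3 ≤ 8 * suc (suc d)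
  next-hi = begin
    suc (suc r) ^ 3 ≤⟨ ^-monoˡ-≤ 3 (s≤s (≤-trans (≤-reflexive (+-comm 1 r)) (+-monoʳ-≤ r (s≤s z≤n)))) ⟩
    (2 * suc r) ^ 3 ≡⟨ [2x]^3≡8*x^3 (suc r) ⟩
    8 * suc r ^ 3   ≡⟨ cong (8 *_) exact ⟩
    8 * suc d       ≤⟨ *-monoʳ-≤ 8 (n≤1+n (suc d)) ⟩
    8 * suc (suc d) ∎
    where open ≤-Reasoning

cube-root-≤ : ∀ {r₀ d r} → r₀ ^ 3 ≤ 8 * d → d ≤ r ^ 3 → r₀ ≤ 2 * r
cube-root-≤ {r₀} {d} {r} hi d≤r³ = ≮⇒≥ λ 2r<r₀ → <-irrefl refl (begin-strict
  (2 * r) ^ 3 <⟨ ^-monoˡ-< 3 2r<r₀ ⟩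
  r₀ ^ 3      ≤⟨ hi ⟩
  8 * d       ≤⟨ *-monoʳ-≤ 8 d≤r³ ⟩
  8 * r ^ 3   ≡⟨ [2x]^3≡8*x^3 r ⟨
  (2 * r) ^ 3 ∎)
  where open ≤-Reasoning

n*[q+1]≡n+q*n : ∀ n q → n * (q + 1) ≡ n + q * n
n*[q+1]≡n+q*n = solve-∀

m<n*[m/n+1] : ∀ m n .{{_ : NonZero n}} → m < n * (m / n + 1)
m<n*[m/n+1] m n = begin-strict
  m                 ≡⟨ m≡m%n+[m/n]*n m n ⟩
  m % n + m / n * n <⟨ +-monoˡ-< (m / n * n) (m%n<n m n) ⟩
  n + m / n * n     ≡⟨ n*[q+1]≡n+q*n n (m / n) ⟨
  n * (m / n + 1)   ∎
  where open ≤-Reasoning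

n*[m/n+1]≤m+n : ∀ m n .{{_ : NonZero n}} → n * (m / n + 1) ≤ m + n
n*[m/n+1]≤m+n m n = begin
  n * (m / n + 1) ≡⟨ n*[q+1]≡n+q*n n (m / n) ⟩
  n + m / n * n   ≤⟨ +-monoʳ-≤ n (m/n*n≤m m n) ⟩
  n + m           ≡⟨ +-comm n m ⟩
  m + n           ∎
  where open ≤-Reasoning

stage-cost : ∀ {d r r₀ L b M} k .{{_ : NonZero k}} → b ≤ d → M ≤ r₀ * k → r₀ * k ≤ 8 * d → r₀ ≤ 2 * r →
             b + (2 * L / k + 1) * (2 * M) ≤ 17 * (r * L + d)
stage-cost {d} {r} {r₀} {L} {b} {M} k b≤d M≤r₀k r₀k≤8d r₀≤2r = begin
  b + rounds * (2 * M)              ≤⟨ +-mono-≤ b≤d (*-monoʳ-≤ rounds (*-monoʳ-≤ 2 M≤r₀k)) ⟩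
  d + rounds * (2 * (r₀ * k))       ≡⟨ cong (d +_) (regroup rounds r₀ k) ⟩
  d + 2 * r₀ * (k * rounds)         ≤⟨ +-monoʳ-≤ d (*-monoʳ-≤ (2 * r₀) (n*[m/n+1]≤m+n (2 * L) k)) ⟩
  d + 2 * r₀ * (2 * L + k)          ≡⟨ expand d r₀ L k ⟩
  d + 4 * (r₀ * L) + 2 * (r₀ * k)   ≤⟨ +-mono-≤ (+-monoʳ-≤ d (*-monoʳ-≤ 4 (*-monoˡ-≤ L r₀≤2r))) (*-monoʳ-≤ 2 r₀k≤8d) ⟩
  d + 4 * (2 * r * L) + 2 * (8 * d) ≡⟨ collect d r L ⟩
  8 * (r * L) + 17 * d              ≤⟨ +-monoˡ-≤ (17 * d) (*-monoˡ-≤ (r * L) (m≤m+n 8 9)) ⟩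
  17 * (r * L) + 17 * d             ≡⟨ *-distribˡ-+ 17 (r * L) d ⟨
  17 * (r * L + d)                  ∎
  where
  open ≤-Reasoning
  rounds : ℕ
  rounds = 2 * L / k + 1
  regroup : ∀ t r₀ k → t * (2 * (r₀ * k)) ≡ 2 * r₀ * (k * t)
  regroup = solve-∀
  expand : ∀ d r₀ L k → d + 2 * r₀ * (2 * L + k) ≡ d + 4 * (r₀ * L) + 2 * (r₀ * k)
  expand = solve-∀
  collect : ∀ d r L → d + 4 * (2 * r * L) + 2 * (8 * d) ≡ 8 * (r * L) + 17 * d
  collect = solve-∀

module CubeRootStages {n : ℕ} (E : List (Subset n)) (d′ : ℕ) where

  d r₀ L : ℕ
  d  = suc d′
  r₀ = suc (proj₁ (cube-root d′))
  L  = ⌈log₂ length E ⌉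

  d≤r₀³ : d ≤ r₀ * (r₀ * r₀)
  d≤r₀³ = subst (d ≤_) (cong (λ x → r₀ * (r₀ * x)) (*-identityʳ r₀)) (proj₁ (proj₂ (cube-root d′)))

  r₀³≤8d : r₀ * (r₀ * r₀) ≤ 8 * d
  r₀³≤8d = subst (_≤ 8 * d) (cong (λ x → r₀ * (r₀ * x)) (*-identityʳ r₀)) (proj₂ (proj₂ (cube-root d′)))

  r₀²≤8d : r₀ * r₀ ≤ 8 * d
  r₀²≤8d = ≤-trans (m≤n*m (r₀ * r₀) r₀) r₀³≤8d

  r₀≤8d : r₀ * 1 ≤ 8 * d
  r₀≤8d = ≤-trans (*-monoʳ-≤ r₀ (s≤s (z≤n {proj₁ (cube-root d′)}))) r₀²≤8d

  few-pairs : ∀ k .{{_ : NonZero k}} → length E * length E < 2 ^ (k * (2 * L / k + 1))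
  few-pairs k = begin-strict
    length E * length E       ≤⟨ *-mono-≤ (n≤2^⌈log₂n⌉ (length E)) (n≤2^⌈log₂n⌉ (length E)) ⟩
    2 ^ L * 2 ^ L             ≡⟨ ^-distribˡ-+-* 2 L L ⟨
    2 ^ (L + L)               ≡⟨ cong (λ x → 2 ^ (L + x)) (+-identityʳ L) ⟨
    2 ^ (2 * L)               <⟨ ^-monoʳ-< 2 (s≤s (s≤s z≤n)) (m<n*[m/n+1] (2 * L) k) ⟩
    2 ^ (k * (2 * L / k + 1)) ∎
    where open ≤-Reasoning

  stage : (B : Subset n) (M k : ℕ) .{{_ : NonZero M}} .{{_ : NonZero k}} →
          Σ (List (Subset n)) λ Ts → length Ts ≡ ∣ B ∣ + (2 * L / k + 1) * (2 * M) × Separates E B M k Ts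
  stage B M k = refinement E B M k (2 * L / k + 1) (few-pairs k)

  T₁ : List (Subset n)
  T₁ = proj₁ (stage ⊥ d (r₀ * r₀))

  T₂ T₃ : Subset n → List (Subset n)
  T₂ B = proj₁ (stage B (r₀ * r₀) r₀)
  T₃ B = proj₁ (stage B r₀ 1)

  open ThreeStages E T₁ T₂ T₃ using (finds; cost-≤)
  open ThreeStages E T₁ T₂ T₃ public using (algorithm)

  correct : All (λ e → ∣ e ∣ ≤ d) E → Finds algorithm E
  correct small = finds small (proj₂ (proj₂ (stage ⊥ d (r₀ * r₀))))
    (λ B → proj₂ (proj₂ (stage B (r₀ * r₀) r₀))) (λ B → proj₂ (proj₂ (stage B r₀ 1)))

  module _ (r : ℕ) (d≤r³ : d ≤ r ^ 3) where

    r₀≤2r : r₀ ≤ 2 * r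
    r₀≤2r = cube-root-≤ {r₀} {d} {r} (proj₂ (proj₂ (cube-root d′))) d≤r³

    stage-length : ∀ B M k .{{_ : NonZero M}} .{{_ : NonZero k}} →
      ∣ B ∣ ≤ d → M ≤ r₀ * k → r₀ * k ≤ 8 * d → length (proj₁ (stage B M k)) ≤ 17 * (r * L + d)
    stage-length B M k ∣B∣≤d M≤r₀k r₀k≤8d = subst (_≤ 17 * (r * L + d)) (sym (proj₁ (proj₂ (stage B M k))))
      (stage-cost {d} {r} {r₀} {L} k ∣B∣≤d M≤r₀k r₀k≤8d r₀≤2r)

    efficient : All (λ e → ∣ e ∣ ≤ d) E → ∀ e → e ∈ E → cost algorithm e ≤ 51 * (r * L + d)
    efficient small e e∈E = ≤-trans
      (cost-≤ {17 * (r * L + d)}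
        (stage-length ⊥ d (r₀ * r₀) (≤-trans (≤-reflexive (∣⊥∣≡0 n)) z≤n) d≤r₀³ r₀³≤8d)
        (λ {B} B∈E → stage-length B (r₀ * r₀) r₀ (All.lookup small B∈E) ≤-refl r₀²≤8d)
        (λ {B} B∈E → stage-length B r₀ 1 (All.lookup small B∈E) (≤-reflexive (sym (*-identityʳ r₀))) r₀≤8d)
        e∈E)
      (≤-reflexive (17x+17x+17x≡51x (r * L + d)))
      where
      17x+17x+17x≡51x : ∀ x → 17 * x + 17 * x + 17 * x ≡ 51 * x
      17x+17x+17x≡51x = solve-∀

hypergraph-testing : (n d : ℕ) (E : List (Subset n)) → All (λ e → ∣ e ∣ ≤ d) E →
  Σ (ThreeStage n) λ A → Finds A E ×
    ((r : ℕ) → d ≤ r ^ 3 → (e : Subset n) → e ∈ E → cost A e ≤ 51 * (r * ⌈log₂ length E ⌉ + d))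
hypergraph-testing n zero     E small =
  no-tests , (λ e e∈E → sym (∣p∣≤0⇒p≡⊥ e (All.lookup small e∈E))) , (λ _ _ _ _ → z≤n)
  where
  no-tests : ThreeStage n
  no-tests = record { stage1 = [] ; stage2 = λ _ → [] ; stage3 = λ _ _ → [] ; output = λ _ _ _ → ⊥ }
hypergraph-testing n (suc d′) E small = algorithm , correct small , λ r d≤r³ → efficient r d≤r³ small
  where open CubeRootStages E d′

corollary5 : Σ ℕ λ C → (n d : ℕ) (E : List (Subset n)) → Unique E →
               All (λ e → ∣ e ∣ ≤ d) E →
               Σ (ThreeStage n) λ A → Finds A E ×
                 ((r : ℕ) → d ≤ r ^ 3 → (e : Subset n) → e ∈ E →
                   cost A e ≤ C * (r * ⌈log₂ length E ⌉ + d))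
corollary5 = 51 , λ n d E _ → hypergraph-testing n d E
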